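{- The coefficient of $q^n$ in the power series expansion of $(1-q)^2(-q;q)_\infty$ is nonnegative for every $n\geq 0$ except $n=1$ and $n=4$.
   Context: $(a;q)_\infty=\prod_{j\geq 0}(1-aq^j)$, so $(-q;q)_\infty=\prod_{j\geq1}(1+q^j)$. -}

module Defs where

open import Data.Nat as ℕ using (ℕ; zero; suc; _∸_; _≤ᵇ_)
open import Data.Integer using (ℤ; +_; _+_; _*_; -_; 0ℤ; 1ℤ)
open import Data.Bool using (if_then_else_)

PowerSeries : Set
PowerSeries = ℕ → ℤ

sumTo : ℕ → (ℕ → ℤ) → ℤ
sumTo zero    f = f 0
sumTo (suc n) f = sumTo n f + f (suc n)

_⊛_ : PowerSeries → PowerSeries → PowerSeries
(f ⊛ g) n = sumTo n (λ k → f k * g (n ∸ k))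

one : PowerSeries
one zero    = 1ℤ
one (suc _) = 0ℤ

mono : ℕ → PowerSeries
mono j n = if (j ℕ.≤ᵇ n) ∧' (n ℕ.≤ᵇ j) then 1ℤ else 0ℤ
  where
  open import Data.Bool using () renaming (_∧_ to _∧'_)

onePlusQ^ : ℕ → PowerSeries
onePlusQ^ j n = one n + mono j n

oneMinusQ : PowerSeries
oneMinusQ n = one n + (- mono 1 n)

partialProd : ℕ → PowerSeries
partialProd zero    = one
partialProd (suc N) = partialProd N ⊛ onePlusQ^ (suc N)

-- (-q;q)_∞ = ∏_{j≥1} (1 + q^j).  As a formal power series, its coefficient of
-- q^n equals that of the partial product ∏_{j=1}^{N} (1+q^j) for any N ≥ n
-- (factors with j > n are ≡ 1 mod q^{n+1}); we take N = n.
minusQPochInf : PowerSeries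
minusQPochInf n = partialProd n n

target : PowerSeries
target = (oneMinusQ ⊛ oneMinusQ) ⊛ minusQPochInf

-- By Euler's identity (-q;q)_∞ = 1/(q;q²)_∞, the series is (1 - q)/∏_{j≥1} (1 - q^(2j+1)), and
-- its coefficient of q^n is already that of the truncation at M odd factors once 2M + 3 > n.
-- The first truncations are explicit: at M = 1 the coefficients have period 3, at M = 2
-- period 15, and at M = 3 they grow by 1 every 105 coefficients, so the only negative ones
-- are a few -1's at small n. Each further division by 1 - q^(2M+3) adds coefficient n - 2M - 3 to
-- coefficient n, so no new negative coefficient can arise beyond a checked range; by M = 9
-- the exceptions have shrunk to n = 1 and n = 4, and from then on they are stable.

module Submission where

open import Defs
open import Data.Nat using (ℕ)
open import Data.Integer using (ℤ; _≤_; 0ℤ)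
open import Relation.Binary.PropositionalEquality using (_≢_)

open import Data.Nat as ℕ
  using (zero; suc; _∸_; z≤n; s≤s)
  renaming (_+_ to _+ℕ_; _*_ to _*ℕ_; _≤_ to _≤ℕ_; _<_ to _<ℕ_)
import Data.Nat.Properties as ℕP
open import Data.Nat.Induction using (<-rec)
import Data.Nat.Tactic.RingSolver as ℕSolver
open import Data.Integer using (_+_; _*_; _-_; 1ℤ; -[1+_])
import Data.Integer.Properties as ℤP
open import Data.Integer.Tactic.RingSolver using (solve-∀)
open import Data.Bool using (true; false; T; if_then_else_)
open import Data.Unit using (tt)
open import Data.List using (List; []; _∷_)
open import Data.List.Relation.Unary.All using (All; []; _∷_; all?)
open import Data.Product using (Σ; _,_)
open import Data.Sum using (_⊎_; inj₁; inj₂)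
open import Data.Empty using (⊥-elim)
open import Function using (_∘′_)
open import Relation.Binary.PropositionalEquality
open import Relation.Nullary.Decidable using (from-yes)
import Relation.Binary.Reasoning.Setoid as SetoidReasoning

module ≗-Reasoning = SetoidReasoning (ℕ →-setoid ℤ)

infixl 6 _⊕_ _⊖_

_⊕_ _⊖_ : PowerSeries → PowerSeries → PowerSeries
(f ⊕ g) k = f k + g k
(f ⊖ g) k = f k - g k

shift : ℕ → PowerSeries → PowerSeries
shift zero    f k       = f k
shift (suc a) f zero    = 0ℤ
shift (suc a) f (suc k) = shift a f k

mul1+q^ mul1-q^ : ℕ → PowerSeries → PowerSeries
mul1+q^ a f = f ⊕ shift a f
mul1-q^ a f = f ⊖ shift a f

shift-< : ∀ a f k → k <ℕ a → shift a f k ≡ 0ℤ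
shift-< (suc a) f zero    _         = refl
shift-< (suc a) f (suc k) (s≤s k<a) = shift-< a f k k<a

shift-+ : ∀ a f k → shift a f (a +ℕ k) ≡ f k
shift-+ zero    f k = refl
shift-+ (suc a) f k = shift-+ a f k

shift-∸ : ∀ a f k → a ≤ℕ k → shift a f k ≡ f (k ∸ a)
shift-∸ a f k a≤k with ℕP.m≤n⇒∃[o]m+o≡n a≤k
... | j , refl = trans (shift-+ a f j) (cong f (sym (ℕP.m+n∸m≡n a j)))

shift-cong : ∀ a {f g} → f ≗ g → shift a f ≗ shift a g
shift-cong zero    f≗g k       = f≗g k
shift-cong (suc a) f≗g zero    = refl
shift-cong (suc a) f≗g (suc k) = shift-cong a f≗g k

shift-local : ∀ a f g k → (∀ j → j ≤ℕ k → f j ≡ g j) → shift a f k ≡ shift a g k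
shift-local zero    f g k       f≡g = f≡g k ℕP.≤-refl
shift-local (suc a) f g zero    f≡g = refl
shift-local (suc a) f g (suc k) f≡g = shift-local a f g k (λ j j≤k → f≡g j (ℕP.m≤n⇒m≤1+n j≤k))

shift-suc-local : ∀ b f g k → (∀ j → j <ℕ k → f j ≡ g j) → shift (suc b) f k ≡ shift (suc b) g k
shift-suc-local b f g zero    f≡g = refl
shift-suc-local b f g (suc k) f≡g = shift-local b f g k (λ j j≤k → f≡g j (s≤s j≤k))

shift-shift : ∀ a b f → shift a (shift b f) ≗ shift (a +ℕ b) f
shift-shift zero    b f k       = refl
shift-shift (suc a) b f zero    = refl
shift-shift (suc a) b f (suc k) = shift-shift a b f k

shift-comm : ∀ a b f → shift a (shift b f) ≗ shift b (shift a f)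
shift-comm a b f k = begin
  shift a (shift b f) k  ≡⟨ shift-shift a b f k ⟩
  shift (a +ℕ b) f k     ≡⟨ cong (λ c → shift c f k) (ℕP.+-comm a b) ⟩
  shift (b +ℕ a) f k     ≡⟨ shift-shift b a f k ⟨
  shift b (shift a f) k  ∎
  where open ≡-Reasoning

shift-⊕ : ∀ a f g → shift a (f ⊕ g) ≗ shift a f ⊕ shift a g
shift-⊕ zero    f g k       = refl
shift-⊕ (suc a) f g zero    = refl
shift-⊕ (suc a) f g (suc k) = shift-⊕ a f g k

shift-⊖ : ∀ a f g → shift a (f ⊖ g) ≗ shift a f ⊖ shift a g
shift-⊖ zero    f g k       = refl
shift-⊖ (suc a) f g zero    = refl
shift-⊖ (suc a) f g (suc k) = shift-⊖ a f g k

mul1+q^-cong : ∀ a {f g} → f ≗ g → mul1+q^ a f ≗ mul1+q^ a g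
mul1+q^-cong a f≗g k = cong₂ _+_ (f≗g k) (shift-cong a f≗g k)

mul1-q^-cong : ∀ a {f g} → f ≗ g → mul1-q^ a f ≗ mul1-q^ a g
mul1-q^-cong a f≗g k = cong₂ _-_ (f≗g k) (shift-cong a f≗g k)

mul1-q^-< : ∀ a f k → k <ℕ a → mul1-q^ a f k ≡ f k
mul1-q^-< a f k k<a = trans (cong (_-_ (f k)) (shift-< a f k k<a)) (ℤP.+-identityʳ (f k))

mul1-q^-comm : ∀ a b f → mul1-q^ a (mul1-q^ b f) ≗ mul1-q^ b (mul1-q^ a f)
mul1-q^-comm a b f k = begin
  (f k - sb f) - shift a (mul1-q^ b f) k   ≡⟨ cong (_-_ (f k - sb f)) (shift-⊖ a f (shift b f) k) ⟩
  (f k - sb f) - (sa f - sa (shift b f))   ≡⟨ cong (λ z → (f k - sb f) - (sa f - z)) (shift-comm a b f k) ⟩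
  (f k - sb f) - (sa f - sb (shift a f))   ≡⟨ exchange (f k) (sb f) (sa f) (sb (shift a f)) ⟩
  (f k - sa f) - (sb f - sb (shift a f))   ≡⟨ cong (_-_ (f k - sa f)) (shift-⊖ b f (shift a f) k) ⟨
  (f k - sa f) - shift b (mul1-q^ a f) k   ∎
  where
  open ≡-Reasoning
  sa sb : PowerSeries → ℤ
  sa g = shift a g k
  sb g = shift b g k
  exchange : ∀ x y z w → (x - y) - (z - w) ≡ (x - z) - (y - w)
  exchange = solve-∀

mul1-q^-mul1+q^ : ∀ a b f → mul1-q^ a (mul1+q^ b f) ≗ mul1+q^ b (mul1-q^ a f)
mul1-q^-mul1+q^ a b f k = begin
  (f k + sb f) - shift a (mul1+q^ b f) k   ≡⟨ cong (_-_ (f k + sb f)) (shift-⊕ a f (shift b f) k) ⟩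
  (f k + sb f) - (sa f + sa (shift b f))   ≡⟨ cong (λ z → (f k + sb f) - (sa f + z)) (shift-comm a b f k) ⟩
  (f k + sb f) - (sa f + sb (shift a f))   ≡⟨ exchange (f k) (sb f) (sa f) (sb (shift a f)) ⟩
  (f k - sa f) + (sb f - sb (shift a f))   ≡⟨ cong ((f k - sa f) +_) (shift-⊖ b f (shift a f) k) ⟨
  (f k - sa f) + shift b (mul1-q^ a f) k   ∎
  where
  open ≡-Reasoning
  sa sb : PowerSeries → ℤ
  sa g = shift a g k
  sb g = shift b g k
  exchange : ∀ x y z w → (x + y) - (z + w) ≡ (x - z) + (y - w)
  exchange = solve-∀

mul1+q^-mul1-q^ : ∀ a f → mul1+q^ a (mul1-q^ a f) ≗ mul1-q^ (a +ℕ a) f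
mul1+q^-mul1-q^ a f k = begin
  (f k - sa f) + shift a (mul1-q^ a f) k   ≡⟨ cong ((f k - sa f) +_) (shift-⊖ a f (shift a f) k) ⟩
  (f k - sa f) + (sa f - sa (shift a f))   ≡⟨ cong (λ z → (f k - sa f) + (sa f - z)) (shift-shift a a f k) ⟩
  (f k - sa f) + (sa f - shift (a +ℕ a) f k) ≡⟨ telescope (f k) (sa f) (shift (a +ℕ a) f k) ⟩
  f k - shift (a +ℕ a) f k                 ∎
  where
  open ≡-Reasoning
  sa : PowerSeries → ℤ
  sa g = shift a g k
  telescope : ∀ x y z → (x - y) + (y - z) ≡ x - z
  telescope = solve-∀

-- f / (1 - q^(suc b)) is the fixed point of d ↦ f + q^(suc b) d; suc k iterations fix coefficient k.
div1-q^suc-fuel : ℕ → PowerSeries → ℕ → PowerSeries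
div1-q^suc-fuel b f zero    = f
div1-q^suc-fuel b f (suc n) = f ⊕ shift (suc b) (div1-q^suc-fuel b f n)

div1-q^suc : ℕ → PowerSeries → PowerSeries
div1-q^suc b f k = div1-q^suc-fuel b f (suc k) k

div1-q^suc-fuel-irrelevant : ∀ b f m n k → k <ℕ m → k <ℕ n →
                             div1-q^suc-fuel b f m k ≡ div1-q^suc-fuel b f n k
div1-q^suc-fuel-irrelevant b f (suc m) (suc n) k (s≤s k≤m) (s≤s k≤n) =
  cong (f k +_) (shift-suc-local b _ _ k λ j j<k →
    div1-q^suc-fuel-irrelevant b f m n j (ℕP.<-≤-trans j<k k≤m) (ℕP.<-≤-trans j<k k≤n))

div1-q^suc-rec : ∀ b f → div1-q^suc b f ≗ f ⊕ shift (suc b) (div1-q^suc b f)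
div1-q^suc-rec b f k = cong (f k +_) (shift-suc-local b _ _ k λ j j<k →
  div1-q^suc-fuel-irrelevant b f k (suc j) j j<k ℕP.≤-refl)

div1-q^suc-< : ∀ b f k → k <ℕ suc b → div1-q^suc b f k ≡ f k
div1-q^suc-< b f k k<b =
  trans (div1-q^suc-rec b f k) (trans (cong (f k +_) (shift-< (suc b) _ k k<b)) (ℤP.+-identityʳ (f k)))

div1-q^suc-+ : ∀ b f k → div1-q^suc b f (suc b +ℕ k) ≡ f (suc b +ℕ k) + div1-q^suc b f k
div1-q^suc-+ b f k = trans (div1-q^suc-rec b f _) (cong (f (suc b +ℕ k) +_) (shift-+ (suc b) _ k))

mul1-q^-div1-q^suc : ∀ b f → mul1-q^ (suc b) (div1-q^suc b f) ≗ f
mul1-q^-div1-q^suc b f k =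
  trans (cong (_- shift (suc b) (div1-q^suc b f) k) (div1-q^suc-rec b f k)) (cancel (f k) _)
  where
  cancel : ∀ x y → (x + y) - y ≡ x
  cancel = solve-∀

sumTo-cong : ∀ n f g → (∀ k → k ≤ℕ n → f k ≡ g k) → sumTo n f ≡ sumTo n g
sumTo-cong zero    f g f≡g = f≡g 0 z≤n
sumTo-cong (suc n) f g f≡g =
  cong₂ _+_ (sumTo-cong n f g (λ k k≤n → f≡g k (ℕP.m≤n⇒m≤1+n k≤n))) (f≡g (suc n) ℕP.≤-refl)

sumTo-zero : ∀ n f → (∀ k → k ≤ℕ n → f k ≡ 0ℤ) → sumTo n f ≡ 0ℤ
sumTo-zero n f f≡0 = trans (sumTo-cong n f (λ _ → 0ℤ) f≡0) (zeros n)
  where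
  zeros : ∀ n → sumTo n (λ _ → 0ℤ) ≡ 0ℤ
  zeros zero    = refl
  zeros (suc n) = cong (_+ 0ℤ) (zeros n)

sumTo-⊕ : ∀ n f g → sumTo n (f ⊕ g) ≡ sumTo n f + sumTo n g
sumTo-⊕ zero    f g = refl
sumTo-⊕ (suc n) f g =
  trans (cong (_+ (f (suc n) + g (suc n))) (sumTo-⊕ n f g))
        (exchange (sumTo n f) (sumTo n g) (f (suc n)) (g (suc n)))
  where
  exchange : ∀ a b c d → (a + b) + (c + d) ≡ (a + c) + (b + d)
  exchange = solve-∀

sumTo-suc : ∀ n f → sumTo (suc n) f ≡ f 0 + sumTo n (λ k → f (suc k))
sumTo-suc zero    f = refl
sumTo-suc (suc n) f =
  trans (cong (_+ f (suc (suc n))) (sumTo-suc n f)) (ℤP.+-assoc (f 0) _ (f (suc (suc n))))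

sumTo-reverse : ∀ n f → sumTo n f ≡ sumTo n (λ k → f (n ∸ k))
sumTo-reverse zero    f = refl
sumTo-reverse (suc n) f = begin
  sumTo (suc n) f                                  ≡⟨ sumTo-suc n f ⟩
  f 0 + sumTo n (λ k → f (suc k))                  ≡⟨ ℤP.+-comm (f 0) _ ⟩
  sumTo n (λ k → f (suc k)) + f 0                  ≡⟨ cong (_+ f 0) (sumTo-reverse n _) ⟩
  sumTo n (λ k → f (suc (n ∸ k))) + f 0            ≡⟨ cong₂ _+_ (sumTo-cong n _ _ λ k k≤n →
                                                        cong f (sym (ℕP.+-∸-assoc 1 k≤n)))
                                                       (cong f (sym (ℕP.n∸n≡0 n))) ⟩
  sumTo n (λ k → f (suc n ∸ k)) + f (suc n ∸ suc n) ∎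
  where open ≡-Reasoning

mono-suc : ∀ j k → mono (suc j) (suc k) ≡ mono j k
mono-suc zero    zero    = refl
mono-suc zero    (suc k) = refl
mono-suc (suc j) zero    = refl
mono-suc (suc j) (suc k) = refl

mono-≢ : ∀ j k → j ≢ k → mono j k ≡ 0ℤ
mono-≢ zero    zero    j≢k = ⊥-elim (j≢k refl)
mono-≢ zero    (suc k) j≢k = refl
mono-≢ (suc j) zero    j≢k = refl
mono-≢ (suc j) (suc k) j≢k = trans (mono-suc j k) (mono-≢ j k (j≢k ∘′ cong suc))

mono-refl : ∀ j → mono j j ≡ 1ℤ
mono-refl zero    = refl
mono-refl (suc j) = trans (mono-suc j j) (mono-refl j)

one≗mono0 : one ≗ mono 0
one≗mono0 zero    = refl
one≗mono0 (suc k) = refl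

sumTo-*mono-> : ∀ n j (x : PowerSeries) → n <ℕ j → sumTo n (λ k → x k * mono j k) ≡ 0ℤ
sumTo-*mono-> n j x n<j = sumTo-zero n (λ k → x k * mono j k) λ k k≤n →
  trans (cong (x k *_) (mono-≢ j k λ { refl → ℕP.<⇒≱ n<j k≤n })) (ℤP.*-zeroʳ (x k))

sumTo-*mono-≤ : ∀ n j (x : PowerSeries) → j ≤ℕ n → sumTo n (λ k → x k * mono j k) ≡ x j
sumTo-*mono-≤ n j x j≤n with ℕP.m≤n⇒m<n∨m≡n j≤n
sumTo-*mono-≤ (suc n) j x _ | inj₁ (s≤s j≤n) =
  trans (cong₂ _+_ (sumTo-*mono-≤ n j x j≤n)
                   (trans (cong (x (suc n) *_) (mono-≢ j (suc n) (ℕP.<⇒≢ (s≤s j≤n))))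
                          (ℤP.*-zeroʳ (x (suc n)))))
        (ℤP.+-identityʳ (x j))
sumTo-*mono-≤ zero    .zero    x _ | inj₂ refl = ℤP.*-identityʳ (x 0)
sumTo-*mono-≤ (suc n) .(suc n) x _ | inj₂ refl =
  trans (cong₂ _+_ (sumTo-*mono-> n (suc n) x ℕP.≤-refl)
                   (trans (cong (x (suc n) *_) (mono-refl (suc n))) (ℤP.*-identityʳ (x (suc n)))))
        (ℤP.+-identityˡ (x (suc n)))

sumTo-∸*mono : ∀ n j f → sumTo n (λ k → f (n ∸ k) * mono j k) ≡ shift j f n
sumTo-∸*mono n j f with ℕP.≤-<-connex j n
... | inj₁ j≤n = trans (sumTo-*mono-≤ n j (λ k → f (n ∸ k)) j≤n) (sym (shift-∸ j f n j≤n))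
... | inj₂ n<j = trans (sumTo-*mono-> n j (λ k → f (n ∸ k)) n<j) (sym (shift-< j f n n<j))

⊛-reverse : ∀ f g n → (f ⊛ g) n ≡ sumTo n (λ k → f (n ∸ k) * g k)
⊛-reverse f g n = trans (sumTo-reverse n _) (sumTo-cong n _ _ λ k k≤n →
  cong (λ i → f (n ∸ k) * g i) (ℕP.m∸[m∸n]≡n k≤n))

⊛-onePlusQ^ : ∀ f j → f ⊛ onePlusQ^ j ≗ mul1+q^ j f
⊛-onePlusQ^ f j n = begin
  (f ⊛ onePlusQ^ j) n                                        ≡⟨ ⊛-reverse f (onePlusQ^ j) n ⟩
  sumTo n (λ k → f (n ∸ k) * (one k + mono j k))             ≡⟨ sumTo-cong n _ _ (λ k _ →
                                                                  ℤP.*-distribˡ-+ (f (n ∸ k)) (one k) (mono j k)) ⟩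
  sumTo n ((λ k → f (n ∸ k) * one k) ⊕ (λ k → f (n ∸ k) * mono j k))
                                                             ≡⟨ sumTo-⊕ n _ _ ⟩
  sumTo n (λ k → f (n ∸ k) * one k) + sumTo n (λ k → f (n ∸ k) * mono j k)
                                                             ≡⟨ cong (_+ sumTo n (λ k → f (n ∸ k) * mono j k)) (sumTo-cong n _ _ λ k _ →
                                                                  cong (f (n ∸ k) *_) (one≗mono0 k)) ⟩
  sumTo n (λ k → f (n ∸ k) * mono 0 k) + sumTo n (λ k → f (n ∸ k) * mono j k)
                                                             ≡⟨ cong₂ _+_ (sumTo-∸*mono n 0 f) (sumTo-∸*mono n j f) ⟩
  f n + shift j f n                                          ∎
  where open ≡-Reasoning

distinctProd : ℕ → PowerSeries
distinctProd zero    = one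
distinctProd (suc N) = mul1+q^ (suc N) (distinctProd N)

partialProd≗distinctProd : ∀ N → partialProd N ≗ distinctProd N
partialProd≗distinctProd zero    k = refl
partialProd≗distinctProd (suc N) k =
  trans (⊛-onePlusQ^ (partialProd N) (suc N) k) (mul1+q^-cong (suc N) (partialProd≗distinctProd N) k)

distinctProd-stable : ∀ N k → k ≤ℕ N → distinctProd (suc N) k ≡ distinctProd N k
distinctProd-stable N k k≤N =
  trans (cong (distinctProd N k +_) (shift-< (suc N) (distinctProd N) k (s≤s k≤N))) (ℤP.+-identityʳ _)

squaredDistinct : ℕ → PowerSeries
squaredDistinct N = mul1-q^ 1 (mul1-q^ 1 (distinctProd N))

target≡squaredDistinct : ∀ m → target (2 +ℕ m) ≡ squaredDistinct (2 +ℕ m) (2 +ℕ m)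
target≡squaredDistinct m = begin
  target (2 +ℕ m)                                ≡⟨ sumTo-first3 m _ (λ k → cong (_* P∞ (2 +ℕ m ∸ (3 +ℕ k)))
                                                                                 (square-vanishes k)) ⟩
  1ℤ * P∞ (2 +ℕ m) + -[1+ 1 ] * P∞ (1 +ℕ m) + 1ℤ * P∞ m
                                                 ≡⟨ second-difference (P∞ (2 +ℕ m)) (P∞ (1 +ℕ m)) (P∞ m) ⟩
  (P∞ (2 +ℕ m) - P∞ (1 +ℕ m)) - (P∞ (1 +ℕ m) - P∞ m)
                                                 ≡⟨ cong₂ _-_ (cong₂ _-_ P∞₂ P∞₁) (cong₂ _-_ P∞₁ P∞₀) ⟩
  squaredDistinct (2 +ℕ m) (2 +ℕ m)              ∎
  where
  open ≡-Reasoning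
  P∞ = minusQPochInf
  P = distinctProd (2 +ℕ m)
  square-vanishes : ∀ k → (oneMinusQ ⊛ oneMinusQ) (3 +ℕ k) ≡ 0ℤ
  square-vanishes k = sumTo-zero (3 +ℕ k) _ vanish
    where
    vanish : ∀ i → i ≤ℕ 3 +ℕ k → oneMinusQ i * oneMinusQ (3 +ℕ k ∸ i) ≡ 0ℤ
    vanish 0             _ = refl
    vanish 1             _ = refl
    vanish (suc (suc i)) _ = refl
  sumTo-first3 : ∀ m h → (∀ k → h (3 +ℕ k) ≡ 0ℤ) → sumTo (2 +ℕ m) h ≡ h 0 + h 1 + h 2
  sumTo-first3 zero    h h≡0 = refl
  sumTo-first3 (suc m) h h≡0 = trans (cong₂ _+_ (sumTo-first3 m h h≡0) (h≡0 m)) (ℤP.+-identityʳ _)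
  second-difference : ∀ a b c → 1ℤ * a + -[1+ 1 ] * b + 1ℤ * c ≡ (a - b) - (b - c)
  second-difference = solve-∀
  P∞₂ : P∞ (2 +ℕ m) ≡ P (2 +ℕ m)
  P∞₂ = partialProd≗distinctProd (2 +ℕ m) (2 +ℕ m)
  P∞₁ : P∞ (1 +ℕ m) ≡ P (1 +ℕ m)
  P∞₁ = trans (partialProd≗distinctProd (1 +ℕ m) (1 +ℕ m)) (sym (distinctProd-stable (1 +ℕ m) (1 +ℕ m) ℕP.≤-refl))
  P∞₀ : P∞ m ≡ P m
  P∞₀ = trans (partialProd≗distinctProd m m)
              (sym (trans (distinctProd-stable (1 +ℕ m) m (ℕP.n≤1+n m)) (distinctProd-stable m m ℕP.≤-refl)))

-- Euler's identity

mulEvenFactors : ℕ → ℕ → PowerSeries → PowerSeries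
mulEvenFactors lo zero    f = f
mulEvenFactors lo (suc c) f = mulEvenFactors (suc lo) c (mul1-q^ (suc lo +ℕ suc lo) f)

mulEvenFactors-cong : ∀ lo c {f g} → f ≗ g → mulEvenFactors lo c f ≗ mulEvenFactors lo c g
mulEvenFactors-cong lo zero    f≗g = f≗g
mulEvenFactors-cong lo (suc c) f≗g = mulEvenFactors-cong (suc lo) c (mul1-q^-cong (suc lo +ℕ suc lo) f≗g)

mulEvenFactors-mul1+q^ : ∀ lo c a f → mulEvenFactors lo c (mul1+q^ a f) ≗ mul1+q^ a (mulEvenFactors lo c f)
mulEvenFactors-mul1+q^ lo zero    a f k = refl
mulEvenFactors-mul1+q^ lo (suc c) a f k =
  trans (mulEvenFactors-cong (suc lo) c (mul1-q^-mul1+q^ (suc lo +ℕ suc lo) a f) k)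
        (mulEvenFactors-mul1+q^ (suc lo) c a _ k)

mulEvenFactors-mul1-q^ : ∀ lo c a f → mulEvenFactors lo c (mul1-q^ a f) ≗ mul1-q^ a (mulEvenFactors lo c f)
mulEvenFactors-mul1-q^ lo zero    a f k = refl
mulEvenFactors-mul1-q^ lo (suc c) a f k =
  trans (mulEvenFactors-cong (suc lo) c (mul1-q^-comm (suc lo +ℕ suc lo) a f) k)
        (mulEvenFactors-mul1-q^ (suc lo) c a _ k)

mulEvenFactors-suc : ∀ lo c f →
  mulEvenFactors lo (suc c) f ≗ mul1-q^ ((lo +ℕ suc c) +ℕ (lo +ℕ suc c)) (mulEvenFactors lo c f)
mulEvenFactors-suc lo zero    f k = cong (λ e → mul1-q^ (e +ℕ e) f k) (ℕP.+-comm 1 lo)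
mulEvenFactors-suc lo (suc c) f k =
  trans (mulEvenFactors-suc (suc lo) c _ k)
        (cong (λ e → mul1-q^ (e +ℕ e) (mulEvenFactors lo (suc c) f) k) (sym (ℕP.+-suc lo (suc c))))

mulEvenFactors-< : ∀ lo c f k → k <ℕ suc lo +ℕ suc lo → mulEvenFactors lo c f k ≡ f k
mulEvenFactors-< lo zero    f k k<  = refl
mulEvenFactors-< lo (suc c) f k k<  =
  trans (mulEvenFactors-< (suc lo) c _ k (ℕP.<-≤-trans k< (ℕP.+-mono-≤ (ℕP.n≤1+n (suc lo)) (ℕP.n≤1+n (suc lo)))))
        (mul1-q^-< (suc lo +ℕ suc lo) f k k<)

mul1+q^-absorb : ∀ lo c a f →
  mul1+q^ a (mulEvenFactors lo c (mul1-q^ a f)) ≗ mul1-q^ (a +ℕ a) (mulEvenFactors lo c f)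
mul1+q^-absorb lo c a f = begin
  mul1+q^ a (mulEvenFactors lo c (mul1-q^ a f))  ≈⟨ mulEvenFactors-mul1+q^ lo c a _ ⟨
  mulEvenFactors lo c (mul1+q^ a (mul1-q^ a f))  ≈⟨ mulEvenFactors-cong lo c (mul1+q^-mul1-q^ a f) ⟩
  mulEvenFactors lo c (mul1-q^ (a +ℕ a) f)       ≈⟨ mulEvenFactors-mul1-q^ lo c (a +ℕ a) f ⟩
  mul1-q^ (a +ℕ a) (mulEvenFactors lo c f)       ∎
  where open ≗-Reasoning

oddQuotient : ℕ → PowerSeries
oddQuotient zero    = mul1-q^ 1 one
oddQuotient (suc M) = div1-q^suc (suc M +ℕ suc M) (oddQuotient M)

squaredDistinct-suc : ∀ N → squaredDistinct (suc N) ≗ mul1+q^ (suc N) (squaredDistinct N)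
squaredDistinct-suc N k =
  trans (mul1-q^-cong 1 (mul1-q^-mul1+q^ 1 (suc N) (distinctProd N)) k)
        (mul1-q^-mul1+q^ 1 (suc N) (mul1-q^ 1 (distinctProd N)) k)

-- ∏_{j≤N} (1 + q^j) = ∏_{j≤N} (1 - q^(2j)) / ∏_{j≤N} (1 - q^j): the factors 1 - q^(2i)
-- with 2i ≤ N cancel, leaving those with N < 2i ≤ 2N over the odd ones.
euler-odd  : ∀ m → squaredDistinct (suc (m +ℕ m)) ≗ mulEvenFactors m (suc m) (oddQuotient m)
euler-even : ∀ m → squaredDistinct (suc m +ℕ suc m) ≗ mulEvenFactors (suc m) (suc m) (oddQuotient m)

euler-odd m = begin
  squaredDistinct (suc (m +ℕ m))                                    ≈⟨ squaredDistinct-suc (m +ℕ m) ⟩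
  mul1+q^ a (squaredDistinct (m +ℕ m))                              ≈⟨ mul1+q^-cong a (previous m) ⟩
  mul1+q^ a (mulEvenFactors m m (mul1-q^ a (oddQuotient m)))        ≈⟨ mul1+q^-absorb m m a (oddQuotient m) ⟩
  mul1-q^ (a +ℕ a) (mulEvenFactors m m (oddQuotient m))             ≈⟨ (λ k → cong (λ e → mul1-q^ (e +ℕ e) (mulEvenFactors m m (oddQuotient m)) k)
                                                                            (ℕP.+-suc m m)) ⟨
  mul1-q^ ((m +ℕ suc m) +ℕ (m +ℕ suc m)) (mulEvenFactors m m (oddQuotient m))
                                                                    ≈⟨ mulEvenFactors-suc m m (oddQuotient m) ⟨
  mulEvenFactors m (suc m) (oddQuotient m)                          ∎
  where
  open ≗-Reasoning
  a = suc (m +ℕ m)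
  previous : ∀ m → squaredDistinct (m +ℕ m) ≗ mulEvenFactors m m (mul1-q^ (suc (m +ℕ m)) (oddQuotient m))
  previous zero    = λ _ → refl
  previous (suc m) = begin
    squaredDistinct (suc m +ℕ suc m)                  ≈⟨ euler-even m ⟩
    mulEvenFactors (suc m) (suc m) (oddQuotient m)    ≈⟨ mulEvenFactors-cong (suc m) (suc m)
                                                           (mul1-q^-div1-q^suc (suc m +ℕ suc m) (oddQuotient m)) ⟨
    mulEvenFactors (suc m) (suc m) (mul1-q^ (suc (suc m +ℕ suc m)) (oddQuotient (suc m))) ∎

euler-even m = begin
  squaredDistinct (suc (m +ℕ suc m))                                ≈⟨ squaredDistinct-suc (m +ℕ suc m) ⟩
  mul1+q^ b (squaredDistinct (m +ℕ suc m))                          ≈⟨ mul1+q^-cong b (λ k →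
                                                                         cong (λ N → squaredDistinct N k) (ℕP.+-suc m m)) ⟩
  mul1+q^ b (squaredDistinct (suc (m +ℕ m)))                        ≈⟨ mul1+q^-cong b (euler-odd m) ⟩
  mul1+q^ b (mulEvenFactors (suc m) m (mul1-q^ b (oddQuotient m)))  ≈⟨ mul1+q^-absorb (suc m) m b (oddQuotient m) ⟩
  mul1-q^ (b +ℕ b) (mulEvenFactors (suc m) m (oddQuotient m))       ≈⟨ mulEvenFactors-suc (suc m) m (oddQuotient m) ⟨
  mulEvenFactors (suc m) (suc m) (oddQuotient m)                    ∎
  where
  open ≗-Reasoning
  b = suc m +ℕ suc m

nextOdd : ℕ → ℕ
nextOdd M = suc (suc M +ℕ suc M)

oddQuotient-stable : ∀ {M M'} k → M ≤ℕ M' → k <ℕ nextOdd M → oddQuotient M' k ≡ oddQuotient M k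
oddQuotient-stable {M} {zero}   k z≤n k< = refl
oddQuotient-stable {M} {suc M'} k M≤ k< with ℕP.m≤n⇒m<n∨m≡n M≤
... | inj₂ refl        = refl
... | inj₁ (s≤s M≤M') =
  trans (div1-q^suc-< _ (oddQuotient M') k (ℕP.<-≤-trans k< (s≤s (ℕP.+-mono-≤ M<1+M' M<1+M'))))
        (oddQuotient-stable k M≤M' k<)
  where
  M<1+M' = s≤s M≤M'

even-or-odd : ∀ m → Σ ℕ (λ j → m ≡ j +ℕ j ⊎ m ≡ suc (j +ℕ j))
even-or-odd zero    = 0 , inj₁ refl
even-or-odd (suc m) with even-or-odd m
... | j , inj₁ refl = j , inj₂ refl
... | j , inj₂ refl = suc j , inj₁ (cong suc (sym (ℕP.+-suc j j)))

target≡oddQuotient : ∀ m M → m ≤ℕ M → target (2 +ℕ m) ≡ oddQuotient M (2 +ℕ m)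
target≡oddQuotient m M m≤M with even-or-odd m
... | j , inj₁ refl = begin
  target (2 +ℕ m)                                           ≡⟨ target≡squaredDistinct m ⟩
  squaredDistinct (2 +ℕ m) (2 +ℕ m)                         ≡⟨ cong (λ N → squaredDistinct N (2 +ℕ m)) 2+m≡ ⟩
  squaredDistinct (suc j +ℕ suc j) (2 +ℕ m)                 ≡⟨ euler-even j (2 +ℕ m) ⟩
  mulEvenFactors (suc j) (suc j) (oddQuotient j) (2 +ℕ m)   ≡⟨ mulEvenFactors-< (suc j) (suc j) (oddQuotient j) (2 +ℕ m)
                                                                 (subst (_<ℕ suc (suc j) +ℕ suc (suc j)) (sym 2+m≡)
                                                                   (ℕP.+-mono-< (ℕP.n<1+n (suc j)) (ℕP.n<1+n (suc j)))) ⟩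
  oddQuotient j (2 +ℕ m)                                    ≡⟨ oddQuotient-stable (2 +ℕ m) (ℕP.≤-trans (ℕP.m≤m+n j j) m≤M)
                                                                 (s≤s (ℕP.≤-reflexive 2+m≡)) ⟨
  oddQuotient M (2 +ℕ m)                                    ∎
  where
  open ≡-Reasoning
  2+m≡ : 2 +ℕ m ≡ suc j +ℕ suc j
  2+m≡ = cong suc (sym (ℕP.+-suc j j))
... | j , inj₂ refl = begin
  target (2 +ℕ m)                                                   ≡⟨ target≡squaredDistinct m ⟩
  squaredDistinct (2 +ℕ m) (2 +ℕ m)                                 ≡⟨ cong (λ N → squaredDistinct N (2 +ℕ m)) 2+m≡ ⟩
  squaredDistinct (suc (suc j +ℕ suc j)) (2 +ℕ m)                   ≡⟨ euler-odd (suc j) (2 +ℕ m) ⟩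
  mulEvenFactors (suc j) (suc (suc j)) (oddQuotient (suc j)) (2 +ℕ m) ≡⟨ mulEvenFactors-< (suc j) (suc (suc j)) (oddQuotient (suc j)) (2 +ℕ m)
                                                                         (subst (_<ℕ suc (suc j) +ℕ suc (suc j)) (sym 2+m≡)
                                                                           (s≤s (s≤s (ℕP.≤-reflexive (sym (ℕP.+-suc j (suc j))))))) ⟩
  oddQuotient (suc j) (2 +ℕ m)                                      ≡⟨ oddQuotient-stable (2 +ℕ m) (ℕP.≤-trans (s≤s (ℕP.m≤m+n j j)) m≤M)
                                                                         (subst (_<ℕ nextOdd (suc j)) (sym 2+m≡)
                                                                           (s≤s (s≤s (ℕP.+-monoʳ-≤ (suc j) (ℕP.n≤1+n (suc j)))))) ⟨
  oddQuotient M (2 +ℕ m)                                            ∎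
  where
  open ≡-Reasoning
  2+m≡ : 2 +ℕ m ≡ suc (suc j +ℕ suc j)
  2+m≡ = cong (λ x → suc (suc x)) (sym (ℕP.+-suc j j))

-- The truncations at one, two and three odd factors

periodic-induction : ∀ p (P : ℕ → Set) → (∀ {k} → k <ℕ suc p → P k) →
                     (∀ k → P k → P (suc p +ℕ k)) → ∀ k → P k
periodic-induction p P base step = <-rec P rec
  where
  rec : ∀ k → (∀ {j} → j <ℕ k → P j) → P k
  rec k ih with ℕP.<-≤-connex k (suc p)
  ... | inj₁ k<p = base k<p
  ... | inj₂ p≤k with ℕP.m≤n⇒∃[o]m+o≡n p≤k
  ... | j , refl = step j (ih (s≤s (ℕP.m≤n+m j p)))

div1-q^suc-multiple : ∀ b f c k →
  div1-q^suc b f (suc c *ℕ suc b +ℕ k) ≡ sumTo c (λ i → f (suc i *ℕ suc b +ℕ k)) + div1-q^suc b f k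
div1-q^suc-multiple b f c k = trans (cong (div1-q^suc b f) (assoc c)) (trans (div1-q^suc-+ b f _) (go c))
  where
  assoc : ∀ c → suc c *ℕ suc b +ℕ k ≡ suc b +ℕ (c *ℕ suc b +ℕ k)
  assoc c = ℕP.+-assoc (suc b) (c *ℕ suc b) k
  go : ∀ c → f (suc b +ℕ (c *ℕ suc b +ℕ k)) + div1-q^suc b f (c *ℕ suc b +ℕ k)
           ≡ sumTo c (λ i → f (suc i *ℕ suc b +ℕ k)) + div1-q^suc b f k
  go zero    = cong (λ i → f i + div1-q^suc b f k) (sym (assoc 0))
  go (suc c) = begin
    f (suc b +ℕ (suc c *ℕ suc b +ℕ k)) + div1-q^suc b f (suc c *ℕ suc b +ℕ k)
      ≡⟨ cong₂ (λ i j → f i + j) (sym (assoc (suc c))) (div1-q^suc-multiple b f c k) ⟩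
    f (suc (suc c) *ℕ suc b +ℕ k) + (sumTo c (λ i → f (suc i *ℕ suc b +ℕ k)) + div1-q^suc b f k)
      ≡⟨ regroup (f (suc (suc c) *ℕ suc b +ℕ k)) (sumTo c (λ i → f (suc i *ℕ suc b +ℕ k))) (div1-q^suc b f k) ⟩
    sumTo (suc c) (λ i → f (suc i *ℕ suc b +ℕ k)) + div1-q^suc b f k ∎
    where
    open ≡-Reasoning
    regroup : ∀ x s d → x + (s + d) ≡ (s + x) + d
    regroup = solve-∀

sumTo-periodic : ∀ p c (f : PowerSeries) (g : ℕ → ℕ) → (∀ k → f (p +ℕ k) ≡ f k) →
                 ∀ k → sumTo c (λ i → f (g i +ℕ (p +ℕ k))) ≡ sumTo c (λ i → f (g i +ℕ k))
sumTo-periodic p c f g f-periodic k = sumTo-cong c _ _ λ i _ →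
  trans (cong f (swap (g i) p k)) (f-periodic (g i +ℕ k))
  where
  swap : ∀ x p k → x +ℕ (p +ℕ k) ≡ p +ℕ (x +ℕ k)
  swap = ℕSolver.solve-∀

oddQuotient₁-periodic : ∀ k → oddQuotient 1 (3 +ℕ k) ≡ oddQuotient 1 k
oddQuotient₁-periodic k = trans (div1-q^suc-+ 2 (oddQuotient 0) k) (ℤP.+-identityˡ _)

oddQuotient₂-periodic : ∀ k → oddQuotient 2 (15 +ℕ k) ≡ oddQuotient 2 k
oddQuotient₂-periodic k =
  trans (div1-q^suc-multiple 4 (oddQuotient 1) 2 k)
        (trans (cong (_+ oddQuotient 2 k) (period-sum k)) (ℤP.+-identityˡ _))
  where
  period-sum : ∀ k → sumTo 2 (λ i → oddQuotient 1 (suc i *ℕ 5 +ℕ k)) ≡ 0ℤ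
  period-sum = periodic-induction 2 _
    (from-yes (ℕP.allUpTo? (λ k → sumTo 2 (λ i → oddQuotient 1 (suc i *ℕ 5 +ℕ k)) ℤP.≟ 0ℤ) 3))
    (λ k sum≡0 → trans (sumTo-periodic 3 2 (oddQuotient 1) (λ i → suc i *ℕ 5) oddQuotient₁-periodic k) sum≡0)

oddQuotient₃-drift : ∀ k → oddQuotient 3 (105 +ℕ k) ≡ 1ℤ + oddQuotient 3 k
oddQuotient₃-drift k =
  trans (div1-q^suc-multiple 6 (oddQuotient 2) 14 k) (cong (_+ oddQuotient 3 k) (period-sum k))
  where
  period-sum : ∀ k → sumTo 14 (λ i → oddQuotient 2 (suc i *ℕ 7 +ℕ k)) ≡ 1ℤ
  period-sum = periodic-induction 14 _
    (from-yes (ℕP.allUpTo? (λ k → sumTo 14 (λ i → oddQuotient 2 (suc i *ℕ 7 +ℕ k)) ℤP.≟ 1ℤ) 15))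
    (λ k sum≡1 → trans (sumTo-periodic 15 14 (oddQuotient 2) (λ i → suc i *ℕ 7) oddQuotient₂-periodic k) sum≡1)

indicator : List ℕ → PowerSeries
indicator []       k = 0ℤ
indicator (e ∷ es) k = (if e ℕ.≡ᵇ k then 1ℤ else 0ℤ) + indicator es k

indicator-≥ : ∀ es B k → All (_<ℕ B) es → B ≤ℕ k → indicator es k ≡ 0ℤ
indicator-≥ []       B k []           B≤k = refl
indicator-≥ (e ∷ es) B k (e<B ∷ es<B) B≤k with e ℕ.≡ᵇ k in e≡ᵇk
... | false = trans (ℤP.+-identityˡ _) (indicator-≥ es B k es<B B≤k)
... | true  = ⊥-elim (ℕP.<⇒≢ (ℕP.<-≤-trans e<B B≤k) (ℕP.≡ᵇ⇒≡ e k (subst T (sym e≡ᵇk) tt)))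

NonnegExcept : ℕ → List ℕ → Set
NonnegExcept M es = ∀ k → 0ℤ ≤ oddQuotient M k + indicator es k

oddQuotient₃-≥-1 : ∀ k → 0ℤ ≤ 1ℤ + oddQuotient 3 k
oddQuotient₃-≥-1 = periodic-induction 104 _
  (from-yes (ℕP.allUpTo? (λ k → 0ℤ ℤP.≤? 1ℤ + oddQuotient 3 k) 105))
  (λ k ≥-1 → subst (0ℤ ≤_) (sym (cong (1ℤ +_) (oddQuotient₃-drift k)))
                             (ℤP.≤-trans ≥-1 (ℤP.i≤j+i _ 1ℤ)))

exceptions₃ exceptions₄ exceptions₅ exceptions₇ exceptional : List ℕ
exceptions₃ = 1 ∷ 4 ∷ 11 ∷ 16 ∷ 46 ∷ []
exceptions₄ = 1 ∷ 4 ∷ 11 ∷ 13 ∷ 16 ∷ 22 ∷ 25 ∷ 31 ∷ 34 ∷ 43 ∷ 46 ∷ []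
exceptions₅ = 1 ∷ 4 ∷ 13 ∷ 22 ∷ []
exceptions₇ = 1 ∷ 4 ∷ 19 ∷ []
exceptional = 1 ∷ 4 ∷ []

oddQuotient₃-nonnegExcept : NonnegExcept 3 exceptions₃
oddQuotient₃-nonnegExcept = periodic-induction 104 _
  (from-yes (ℕP.allUpTo? (λ k → 0ℤ ℤP.≤? oddQuotient 3 k + indicator exceptions₃ k) 105))
  (λ k _ → subst (0ℤ ≤_) (sym (beyond k)) (oddQuotient₃-≥-1 k))
  where
  beyond : ∀ k → oddQuotient 3 (105 +ℕ k) + indicator exceptions₃ (105 +ℕ k) ≡ 1ℤ + oddQuotient 3 k
  beyond k = trans (cong₂ _+_ (oddQuotient₃-drift k)
                              (indicator-≥ exceptions₃ 47 (105 +ℕ k) (from-yes (all? (ℕ._<? 47) exceptions₃))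
                                           (ℕP.≤-trans (ℕP.m≤m+n 47 58) (ℕP.m≤m+n 105 k))))
                   (ℤP.+-identityʳ _)

-- Beyond the checked range K, coefficient k of stage M + 1 is coefficient k of stage M plus
-- coefficient k - nextOdd M of stage M + 1, and neither is exceptional.
nonnegExcept-suc : ∀ M es es' K B → NonnegExcept M es → All (_<ℕ K) es → All (_<ℕ B) es' →
                   nextOdd M +ℕ B ≤ℕ K → (∀ {k} → k <ℕ K → 0ℤ ≤ oddQuotient (suc M) k + indicator es' k) →
                   NonnegExcept (suc M) es'
nonnegExcept-suc M es es' K B nonneg es<K es'<B next+B≤K checked =
  periodic-induction (suc M +ℕ suc M) _ (λ k<next → checked (ℕP.<-≤-trans k<next next≤K)) step
  where
  next≤K : nextOdd M ≤ℕ K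
  next≤K = ℕP.≤-trans (ℕP.m≤m+n (nextOdd M) B) next+B≤K
  step : ∀ j → 0ℤ ≤ oddQuotient (suc M) j + indicator es' j →
         0ℤ ≤ oddQuotient (suc M) (nextOdd M +ℕ j) + indicator es' (nextOdd M +ℕ j)
  step j j≥0 with ℕP.<-≤-connex (nextOdd M +ℕ j) K
  ... | inj₁ <K = checked <K
  ... | inj₂ K≤ = subst (0ℤ ≤_) (sym split) (ℤP.+-mono-≤ (nonneg (nextOdd M +ℕ j)) j≥0)
    where
    B≤j : B ≤ℕ j
    B≤j = ℕP.+-cancelˡ-≤ (nextOdd M) B j (ℕP.≤-trans next+B≤K K≤)
    add-zeros : ∀ a c → (a + c) + 0ℤ ≡ (a + 0ℤ) + (c + 0ℤ)
    add-zeros = solve-∀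
    split : oddQuotient (suc M) (nextOdd M +ℕ j) + indicator es' (nextOdd M +ℕ j)
          ≡ (oddQuotient M (nextOdd M +ℕ j) + indicator es (nextOdd M +ℕ j)) + (oddQuotient (suc M) j + indicator es' j)
    split = begin
      oddQuotient (suc M) (nextOdd M +ℕ j) + indicator es' (nextOdd M +ℕ j)
        ≡⟨ cong₂ _+_ (div1-q^suc-+ (suc M +ℕ suc M) (oddQuotient M) j)
                     (indicator-≥ es' B _ es'<B (ℕP.≤-trans B≤j (ℕP.m≤n+m j (nextOdd M)))) ⟩
      (oddQuotient M (nextOdd M +ℕ j) + oddQuotient (suc M) j) + 0ℤ
        ≡⟨ add-zeros (oddQuotient M (nextOdd M +ℕ j)) (oddQuotient (suc M) j) ⟩
      (oddQuotient M (nextOdd M +ℕ j) + 0ℤ) + (oddQuotient (suc M) j + 0ℤ)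
        ≡⟨ cong₂ _+_ (cong (oddQuotient M (nextOdd M +ℕ j) +_) (indicator-≥ es K _ es<K K≤))
                     (cong (oddQuotient (suc M) j +_) (indicator-≥ es' B j es'<B B≤j)) ⟨
      (oddQuotient M (nextOdd M +ℕ j) + indicator es (nextOdd M +ℕ j)) + (oddQuotient (suc M) j + indicator es' j) ∎
      where open ≡-Reasoning

oddQuotient₄-nonnegExcept : NonnegExcept 4 exceptions₄
oddQuotient₄-nonnegExcept = nonnegExcept-suc 3 exceptions₃ exceptions₄ 56 47 oddQuotient₃-nonnegExcept
  (from-yes (all? (ℕ._<? 56) exceptions₃)) (from-yes (all? (ℕ._<? 47) exceptions₄)) (from-yes (9 +ℕ 47 ℕ.≤? 56))
  (from-yes (ℕP.allUpTo? (λ k → 0ℤ ℤP.≤? oddQuotient 4 k + indicator exceptions₄ k) 56))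

oddQuotient₅-nonnegExcept : NonnegExcept 5 exceptions₅
oddQuotient₅-nonnegExcept = nonnegExcept-suc 4 exceptions₄ exceptions₅ 47 23 oddQuotient₄-nonnegExcept
  (from-yes (all? (ℕ._<? 47) exceptions₄)) (from-yes (all? (ℕ._<? 23) exceptions₅)) (from-yes (11 +ℕ 23 ℕ.≤? 47))
  (from-yes (ℕP.allUpTo? (λ k → 0ℤ ℤP.≤? oddQuotient 5 k + indicator exceptions₅ k) 47))

oddQuotient₆-nonnegExcept : NonnegExcept 6 exceptional
oddQuotient₆-nonnegExcept = nonnegExcept-suc 5 exceptions₅ exceptional 23 5 oddQuotient₅-nonnegExcept
  (from-yes (all? (ℕ._<? 23) exceptions₅)) (from-yes (all? (ℕ._<? 5) exceptional)) (from-yes (13 +ℕ 5 ℕ.≤? 23))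
  (from-yes (ℕP.allUpTo? (λ k → 0ℤ ℤP.≤? oddQuotient 6 k + indicator exceptional k) 23))

oddQuotient₇-nonnegExcept : NonnegExcept 7 exceptions₇
oddQuotient₇-nonnegExcept = nonnegExcept-suc 6 exceptional exceptions₇ 36 20 oddQuotient₆-nonnegExcept
  (from-yes (all? (ℕ._<? 36) exceptional)) (from-yes (all? (ℕ._<? 20) exceptions₇)) (from-yes (15 +ℕ 20 ℕ.≤? 36))
  (from-yes (ℕP.allUpTo? (λ k → 0ℤ ℤP.≤? oddQuotient 7 k + indicator exceptions₇ k) 36))

oddQuotient₈-nonnegExcept : NonnegExcept 8 exceptions₇
oddQuotient₈-nonnegExcept = nonnegExcept-suc 7 exceptions₇ exceptions₇ 38 20 oddQuotient₇-nonnegExcept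
  (from-yes (all? (ℕ._<? 38) exceptions₇)) (from-yes (all? (ℕ._<? 20) exceptions₇)) (from-yes (17 +ℕ 20 ℕ.≤? 38))
  (from-yes (ℕP.allUpTo? (λ k → 0ℤ ℤP.≤? oddQuotient 8 k + indicator exceptions₇ k) 38))

oddQuotient₉-nonnegExcept : NonnegExcept 9 exceptional
oddQuotient₉-nonnegExcept = nonnegExcept-suc 8 exceptions₇ exceptional 25 5 oddQuotient₈-nonnegExcept
  (from-yes (all? (ℕ._<? 25) exceptions₇)) (from-yes (all? (ℕ._<? 5) exceptional)) (from-yes (19 +ℕ 5 ℕ.≤? 25))
  (from-yes (ℕP.allUpTo? (λ k → 0ℤ ℤP.≤? oddQuotient 9 k + indicator exceptional k) 25))

corrected : ℕ → PowerSeries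
corrected M = oddQuotient M ⊕ indicator exceptional

-- The deficits at 1 and 4 are paid for by the coefficients at nextOdd M + 1 and + 4. As
-- nextOdd moves by 2, the new coefficient at nextOdd + t is the old one at nextOdd + t + 2
-- plus the one at t + 2; so 3 and 12 keep the window 1, 4, 6, 8, 10 positive.
record Invariant (M : ℕ) : Set where
  field
    nonneg      : ∀ k → 0ℤ ≤ corrected M k
    at-3        : 1ℤ ≤ corrected M 3
    at-12       : 1ℤ ≤ corrected M 12
    at-next+1   : 1ℤ ≤ corrected M (nextOdd M +ℕ 1)
    at-next+4   : 1ℤ ≤ corrected M (nextOdd M +ℕ 4)
    at-next+6   : 1ℤ ≤ corrected M (nextOdd M +ℕ 6)
    at-next+8   : 1ℤ ≤ corrected M (nextOdd M +ℕ 8)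
    at-next+10  : 1ℤ ≤ corrected M (nextOdd M +ℕ 10)

corrected-< : ∀ M k → k <ℕ nextOdd M → corrected (suc M) k ≡ corrected M k
corrected-< M k k<next = cong (_+ indicator exceptional k) (div1-q^suc-< _ (oddQuotient M) k k<next)

corrected-next+ : ∀ M j → corrected (suc M) (nextOdd M +ℕ j)
                  ≡ (corrected M (nextOdd M +ℕ j) - indicator exceptional j) + corrected (suc M) j
corrected-next+ M j =
  trans (cong (_+ indicator exceptional (nextOdd M +ℕ j)) (div1-q^suc-+ (suc M +ℕ suc M) (oddQuotient M) j))
        (regroup (oddQuotient M (nextOdd M +ℕ j)) (oddQuotient (suc M) j)
                 (indicator exceptional (nextOdd M +ℕ j)) (indicator exceptional j))
  where
  regroup : ∀ a c e f → (a + c) + e ≡ ((a + e) - f) + (c + f)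
  regroup = solve-∀

indicator-exceptional-≢ : ∀ n → n ≢ 1 → n ≢ 4 → indicator exceptional n ≡ 0ℤ
indicator-exceptional-≢ 0 _ _ = refl
indicator-exceptional-≢ 1 n≢1 _ = ⊥-elim (n≢1 refl)
indicator-exceptional-≢ 2 _ _ = refl
indicator-exceptional-≢ 3 _ _ = refl
indicator-exceptional-≢ 4 _ n≢4 = ⊥-elim (n≢4 refl)
indicator-exceptional-≢ (suc (suc (suc (suc (suc n))))) _ _ = refl

module _ {M} (inv : Invariant M) where
  open Invariant inv

  exceptions-covered : ∀ j → indicator exceptional j ≤ corrected M (nextOdd M +ℕ j)
  exceptions-covered 1 = at-next+1
  exceptions-covered 4 = at-next+4
  exceptions-covered 0 = nonneg _
  exceptions-covered 2 = nonneg _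
  exceptions-covered 3 = nonneg _
  exceptions-covered (suc (suc (suc (suc (suc j))))) = nonneg _

  Invariant-suc : 12 <ℕ nextOdd M → Invariant (suc M)
  Invariant-suc 12<next = record
    { nonneg     = periodic-induction (suc M +ℕ suc M) _
                     (λ {k} k<next → subst (0ℤ ≤_) (sym (corrected-< M k k<next)) (nonneg k))
                     (λ j j≥0 → subst (0ℤ ≤_) (sym (corrected-next+ M j))
                                  (ℤP.+-mono-≤ (ℤP.i≤j⇒0≤j-i (exceptions-covered j)) j≥0))
    ; at-3       = subst (1ℤ ≤_) (sym (corrected-< M 3 (below 1 tt))) at-3
    ; at-12      = subst (1ℤ ≤_) (sym (corrected-< M 12 12<next)) at-12
    ; at-next+1  = subst (1ℤ ≤_) (sym (moved 1 (below 1 tt) refl)) (ℤP.+-mono-≤ (nonneg _) at-3)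
    ; at-next+4  = subst (1ℤ ≤_) (sym (moved 4 (below 4 tt) refl)) (ℤP.+-mono-≤ at-next+6 (nonneg _))
    ; at-next+6  = subst (1ℤ ≤_) (sym (moved 6 (below 6 tt) refl)) (ℤP.+-mono-≤ at-next+8 (nonneg _))
    ; at-next+8  = subst (1ℤ ≤_) (sym (moved 8 (below 8 tt) refl)) (ℤP.+-mono-≤ at-next+10 (nonneg _))
    ; at-next+10 = subst (1ℤ ≤_) (sym (moved 10 (below 10 tt) refl)) (ℤP.+-mono-≤ (nonneg _) at-12)
    }
    where
    below : ∀ t → T (t ℕ.≤ᵇ 10) → 2 +ℕ t <ℕ nextOdd M
    below t t≤10 = ℕP.≤-<-trans (ℕP.+-monoʳ-≤ 2 (ℕP.≤ᵇ⇒≤ t 10 t≤10)) 12<next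
    next-suc : ∀ M t → suc (suc (suc M) +ℕ suc (suc M)) +ℕ t ≡ suc (suc M +ℕ suc M) +ℕ (2 +ℕ t)
    next-suc = ℕSolver.solve-∀
    moved : ∀ t → 2 +ℕ t <ℕ nextOdd M → indicator exceptional (2 +ℕ t) ≡ 0ℤ →
            corrected (suc M) (nextOdd (suc M) +ℕ t) ≡ corrected M (nextOdd M +ℕ (2 +ℕ t)) + corrected M (2 +ℕ t)
    moved t 2+t<next ι≡0 = begin
      corrected (suc M) (nextOdd (suc M) +ℕ t)
        ≡⟨ cong (corrected (suc M)) (next-suc M t) ⟩
      corrected (suc M) (nextOdd M +ℕ (2 +ℕ t))
        ≡⟨ corrected-next+ M (2 +ℕ t) ⟩
      (corrected M (nextOdd M +ℕ (2 +ℕ t)) - indicator exceptional (2 +ℕ t)) + corrected (suc M) (2 +ℕ t)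
        ≡⟨ cong₂ (λ i c → (corrected M (nextOdd M +ℕ (2 +ℕ t)) - i) + c) ι≡0 (corrected-< M (2 +ℕ t) 2+t<next) ⟩
      (corrected M (nextOdd M +ℕ (2 +ℕ t)) - 0ℤ) + corrected M (2 +ℕ t)
        ≡⟨ cong (_+ corrected M (2 +ℕ t)) (ℤP.+-identityʳ (corrected M (nextOdd M +ℕ (2 +ℕ t)))) ⟩
      corrected M (nextOdd M +ℕ (2 +ℕ t)) + corrected M (2 +ℕ t) ∎
      where open ≡-Reasoning

invariant : ∀ d → Invariant (d +ℕ 9)
invariant zero    = record
  { nonneg     = oddQuotient₉-nonnegExcept
  ; at-3       = from-yes (1ℤ ℤP.≤? corrected 9 3)
  ; at-12      = from-yes (1ℤ ℤP.≤? corrected 9 12)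
  ; at-next+1  = from-yes (1ℤ ℤP.≤? corrected 9 22)
  ; at-next+4  = from-yes (1ℤ ℤP.≤? corrected 9 25)
  ; at-next+6  = from-yes (1ℤ ℤP.≤? corrected 9 27)
  ; at-next+8  = from-yes (1ℤ ℤP.≤? corrected 9 29)
  ; at-next+10 = from-yes (1ℤ ℤP.≤? corrected 9 31)
  }
invariant (suc d) = Invariant-suc (invariant d)
  (s≤s (ℕP.≤-trans (ℕP.m≤m+n 12 8) (ℕP.+-mono-≤ (s≤s (ℕP.m≤n+m 9 d)) (s≤s (ℕP.m≤n+m 9 d)))))

lemma3p1 : (n : ℕ) → n ≢ 1 → n ≢ 4 → 0ℤ ≤ target n
lemma3p1 zero          _   _   = from-yes (0ℤ ℤP.≤? target 0)
lemma3p1 (suc zero)    n≢1 _   = ⊥-elim (n≢1 refl)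
lemma3p1 (suc (suc m)) n≢1 n≢4 = subst (0ℤ ≤_) (sym target≡corrected) (Invariant.nonneg (invariant m) (2 +ℕ m))
  where
  target≡corrected : target (2 +ℕ m) ≡ corrected (m +ℕ 9) (2 +ℕ m)
  target≡corrected = begin
    target (2 +ℕ m)                                                    ≡⟨ target≡oddQuotient m (m +ℕ 9) (ℕP.m≤m+n m 9) ⟩
    oddQuotient (m +ℕ 9) (2 +ℕ m)                                      ≡⟨ ℤP.+-identityʳ _ ⟨
    oddQuotient (m +ℕ 9) (2 +ℕ m) + 0ℤ                                 ≡⟨ cong (oddQuotient (m +ℕ 9) (2 +ℕ m) +_)
                                                                            (indicator-exceptional-≢ (2 +ℕ m) n≢1 n≢4) ⟨
    corrected (m +ℕ 9) (2 +ℕ m)                                        ∎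
    where open ≡-Reasoning
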